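{- Let $k$ be a field. (1) For every positive integer $n$, $\operatorname{dc}(\operatorname{hoperm}_n) \leq 3^n$. (2) For every composition $\mathbf{m}=(m_1,\dots,m_n)$ of a positive integer $\gamma$, $\operatorname{dc}(\operatorname{mperm}_{\mathbf{m}}) \leq \left(\prod_{i=1}^n (m_i+1)\right) - 1$.
   Context: The determinantal complexity $\operatorname{dc}(f)$ of a polynomial $f(x_1,\dots,x_N)$ over $k$ is the minimum $m$ such that there is an $m\times m$ matrix whose entries are affine linear functions of $x_1,\dots,x_N$ with determinant equal to $f$. The hyperoctahedral permanent $\operatorname{hoperm}_n$ is the polynomial in the $2n^2$ variables $x_{i,j}$ ($1\le i\le n$, $j\in\{\pm1,\dots,\pm n\}$) given by $\operatorname{hoperm}_n=\sum_{\sigma\in S_n}\sum_{(\epsilon_1,\dots,\epsilon_n)\in\{\pm1\}^n}\prod_{i=1}^n x_{i,\epsilon_i\sigma(i)}$. For a composition $\mathbf{m}=(m_1,\dots,m_n)$ of $\gamma$ (i.e. $m_i$ positive integers with $m_1+\dots+m_n=\gamma$), the multipermanent is $\operatorname{mperm}_{\mathbf{m}}=\sum_{\sigma\in\Sigma_{\mathbf{m}}}\prod_{i=1}^{\gamma} x_{i,\sigma(i)}$, a polynomial in the variables $x_{i,j}$ ($1\le i\le\gamma$, $1\le j\le n$), where $\Sigma_{\mathbf{m}}$ is the set of functions $\sigma:\{1,\dots,\gamma\}\to\{1,\dots,n\}$ with $|\sigma^{ -1}(j)|=m_j$ for $j=1,\dots,n$. -}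

module Defs where

open import Level using (Level; _⊔_)
open import Algebra.Bundles using (CommutativeRing)
open import Data.Nat as ℕ using (ℕ; zero; suc)
open import Data.Fin as Fin using (Fin; zero; suc; punchIn)
open import Data.Fin.Properties using (all?; _≟_)
open import Data.Bool using (Bool; true; false)
open import Data.List as List using (List; []; _∷_; _++_; filter)
open import Data.Product using (_×_; _,_; Σ-syntax)
open import Relation.Nullary using (¬_; Dec; yes; no)
open import Relation.Nullary.Decidable using (_→-dec_)
open import Relation.Unary using (Decidable)
open import Relation.Binary.PropositionalEquality using (_≡_)

record Field (c ℓ : Level) : Set (Level.suc (c ⊔ ℓ)) where
  field
    commutativeRing : CommutativeRing c ℓ
  open CommutativeRing commutativeRing public
  field
    0≉1     : ¬ (0# ≈ 1#)
    inverse : ∀ x → ¬ (x ≈ 0#) → Σ[ y ∈ Carrier ] (x * y ≈ 1#)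

-- Polynomials over k in a set V of variables: formal expressions modulo
-- the congruence generated by the commutative ring axioms and by the
-- requirement that constants form a copy of k.  The quotient is exactly
-- the polynomial ring k[V] (free commutative k-algebra on V).

module Polynomials {c ℓ : Level} (k : Field c ℓ) where
  open Field k using (Carrier; _≈_; _+_; _*_; -_; 0#; 1#)

  data Poly (V : Set) : Set c where
    var  : V → Poly V
    con  : Carrier → Poly V
    _⊕_  : Poly V → Poly V → Poly V
    _⊗_  : Poly V → Poly V → Poly V

  infixl 6 _⊕_
  infixl 7 _⊗_
  infix 4 _≈ₚ_

  data _≈ₚ_ {V : Set} : Poly V → Poly V → Set (c ⊔ ℓ) where
    ≈-refl    : ∀ {p} → p ≈ₚ p
    ≈-sym     : ∀ {p q} → p ≈ₚ q → q ≈ₚ p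
    ≈-trans   : ∀ {p q r} → p ≈ₚ q → q ≈ₚ r → p ≈ₚ r
    p⊕-cong    : ∀ {p p′ q q′} → p ≈ₚ p′ → q ≈ₚ q′ → p ⊕ q ≈ₚ p′ ⊕ q′
    p⊗-cong    : ∀ {p p′ q q′} → p ≈ₚ p′ → q ≈ₚ q′ → p ⊗ q ≈ₚ p′ ⊗ q′
    p⊕-assoc   : ∀ p q r → (p ⊕ q) ⊕ r ≈ₚ p ⊕ (q ⊕ r)
    p⊕-comm    : ∀ p q → p ⊕ q ≈ₚ q ⊕ p
    p⊕-identity : ∀ p → con 0# ⊕ p ≈ₚ p
    p⊕-inverse : ∀ p → p ⊕ (con (- 1#) ⊗ p) ≈ₚ con 0#
    p⊗-assoc   : ∀ p q r → (p ⊗ q) ⊗ r ≈ₚ p ⊗ (q ⊗ r)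
    p⊗-comm    : ∀ p q → p ⊗ q ≈ₚ q ⊗ p
    p⊗-identity : ∀ p → con 1# ⊗ p ≈ₚ p
    p-distrib   : ∀ p q r → p ⊗ (q ⊕ r) ≈ₚ (p ⊗ q) ⊕ (p ⊗ r)
    p-con-cong  : ∀ {a b} → a ≈ b → con a ≈ₚ con b
    p-con-+     : ∀ a b → con (a + b) ≈ₚ con a ⊕ con b
    p-con-*     : ∀ a b → con (a * b) ≈ₚ con a ⊗ con b

  sumL : ∀ {V : Set} → List (Poly V) → Poly V
  sumL []       = con 0#
  sumL (p ∷ ps) = p ⊕ sumL ps

  Σᶠ : ∀ {V : Set} (n : ℕ) → (Fin n → Poly V) → Poly V
  Σᶠ zero    f = con 0#
  Σᶠ (suc n) f = f zero ⊕ Σᶠ n (λ i → f (suc i))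

  Πᶠ : ∀ {V : Set} (n : ℕ) → (Fin n → Poly V) → Poly V
  Πᶠ zero    f = con 1#
  Πᶠ (suc n) f = f zero ⊗ Πᶠ n (λ i → f (suc i))

  record Affine (N : ℕ) : Set c where
    constructor affine
    field
      const  : Carrier
      coeffs : Fin N → Carrier

  toPoly : ∀ {N} → Affine N → Poly (Fin N)
  toPoly (affine c₀ cs) = con c₀ ⊕ Σᶠ _ (λ v → con (cs v) ⊗ var v)

  sgn : ℕ → Carrier
  sgn zero    = 1#
  sgn (suc j) = - (sgn j)

  det : ∀ {V : Set} (m : ℕ) → (Fin m → Fin m → Poly V) → Poly V
  det zero    A = con 1#
  det (suc m) A =
    Σᶠ (suc m) (λ j → con (sgn (Fin.toℕ j)) ⊗ A zero j
                      ⊗ det m (λ i l → A (suc i) (punchIn j l)))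

  DcAtMost : ∀ {N : ℕ} → Poly (Fin N) → ℕ → Set (c ⊔ ℓ)
  DcAtMost {N} f M =
    Σ[ m ∈ ℕ ] (m ℕ.≤ M × Σ[ A ∈ (Fin m → Fin m → Affine N) ]
                 (det m (λ i j → toPoly (A i j)) ≈ₚ f))

allFuns : ∀ {b} {B : Set b} (a : ℕ) → List B → List (Fin a → B)
allFuns zero    bs = (λ ()) ∷ []
allFuns (suc a) bs =
  List.concatMap (λ b → List.map (λ f → λ { zero → b ; (suc i) → f i })
                                 (allFuns a bs)) bs

fibreSize : ∀ {γ n} → (Fin γ → Fin n) → Fin n → ℕ
fibreSize {zero}  σ j = 0
fibreSize {suc γ} σ j with σ zero ≟ j
... | yes _ = suc (fibreSize (λ i → σ (suc i)) j)
... | no  _ = fibreSize (λ i → σ (suc i)) j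

IsPerm : ∀ {n} → (Fin n → Fin n) → Set
IsPerm σ = ∀ i j → σ i ≡ σ j → i ≡ j

isPerm? : ∀ {n} → Decidable (IsPerm {n})
isPerm? σ = all? (λ i → all? (λ j → (σ i ≟ σ j) →-dec (i ≟ j)))

Sₙ : (n : ℕ) → List (Fin n → Fin n)
Sₙ n = filter isPerm? (allFuns n (List.allFin n))

HasFibres : ∀ {γ n} → (Fin n → ℕ) → (Fin γ → Fin n) → Set
HasFibres m σ = ∀ j → fibreSize σ j ≡ m j

hasFibres? : ∀ {γ n} (m : Fin n → ℕ) → Decidable (HasFibres {γ} m)
hasFibres? m σ = all? (λ j → fibreSize σ j ℕ.≟ m j)

Σₘ : ∀ (γ : ℕ) {n} → (Fin n → ℕ) → List (Fin γ → Fin n)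
Σₘ γ {n} m = filter (hasFibres? m) (allFuns γ (List.allFin n))

-- hoperm variables x_{i,j}, 1 ≤ i ≤ n, j ∈ {±1,…,±n}: the pair (i , (s , j))
-- with s = true for +(j+1) and s = false for -(j+1); encoded in Fin (2n²).
-- mperm variables x_{i,j}, 1 ≤ i ≤ γ, 1 ≤ j ≤ n: encoded in Fin (γ n).

module Polys {c ℓ : Level} (k : Field c ℓ) where
  open Polynomials k public

  hvar : ∀ {n} → Fin n → Bool → Fin n → Fin (n ℕ.* (2 ℕ.* n))
  hvar {n} i s j = Fin.combine i (Fin.combine (sign s) j)
    where
      sign : Bool → Fin 2
      sign true  = zero
      sign false = suc zero

  mvar : ∀ {γ n} → Fin γ → Fin n → Fin (γ ℕ.* n)
  mvar i j = Fin.combine i j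

  hoperm : (n : ℕ) → Poly (Fin (n ℕ.* (2 ℕ.* n)))
  hoperm n =
    sumL (List.concatMap
      (λ σ → List.map (λ ε → Πᶠ n (λ i → var (hvar i (ε i) (σ i))))
                      (allFuns n (true ∷ false ∷ [])))
      (Sₙ n))

  mperm : (γ : ℕ) {n : ℕ} → (Fin n → ℕ) → Poly (Fin (γ ℕ.* n))
  mperm γ m = sumL (List.map (λ σ → Πᶠ γ (λ i → var (mvar i (σ i)))) (Σₘ γ m))

sumℕ : ∀ n → (Fin n → ℕ) → ℕ
sumℕ zero    f = 0
sumℕ (suc n) f = f zero ℕ.+ sumℕ n (λ i → f (suc i))

prodℕ : ∀ n → (Fin n → ℕ) → ℕ
prodℕ zero    f = 1
prodℕ (suc n) f = f zero ℕ.* prodℕ n (λ i → f (suc i))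

{-# OPTIONS --safe #-}

-- Both polynomials are multipermanents of row families, Σ_σ Π_i Y_{i,σ(i)} over the maps σ whose
-- fibres have sizes m (for hoperm_n: m = (1,…,1) and Y_{i,j} = x_{i,j} + x_{i,−j}).  Such a sum is
-- the total path weight of an acyclic branching program on the box {r | 0 ≤ r ≤ m}: from r there is
-- an edge to r − e_b for every b with r_b > 0, weighted by Y_{γ−|r|, b}, so that the paths from m to 0
-- are exactly the admissible σ.  Numbering the Π (m_i + 1) vertices so that every edge goes forward,
-- expansion along the first row shows that the Hessenberg matrix with the weights w(i, j+1) on and
-- above the diagonal and −1 below it has the path weight from the first vertex as determinant.  Its
-- size is Π (m_i + 1) − 1, which for hoperm_n is 2^n − 1 ≤ 3^n.

module Submission where

open import Defs
open import Level using (Level; _⊔_)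
open import Data.Nat as ℕ using (ℕ; zero; suc; pred; _≤_; _<_; _^_; _∸_; _+_; _*_; z≤n; s≤s)
import Data.Nat.Properties as ℕₚ
open import Data.Nat.Properties
  using ( +-suc; +-mono-≤; +-monoʳ-<; *-mono-≤; *-distribʳ-+; *-zeroʳ; +-∸-assoc; m∸n≤m; m<m+n
        ; m∸[m∸n]≡n; n∸n≡0; m+n≡0⇒m≡0; m+n≡0⇒n≡0; ∸-monoʳ-<; pred[n]≤n; suc-pred; suc-injective
        ; ≤-refl; ≤-trans; ≤-reflexive; ≤-pred; ≤-antisym; ≤-<-trans; n<1+n; n≤1+n; 1+n≰n
        ; <⇒≢; <⇒≱; _<?_; module ≤-Reasoning )
open import Data.Fin as Fin using (Fin; zero; suc; toℕ; combine; remQuot)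
import Data.Fin.Properties as Finₚ
open import Data.Vec.Functional using (_∷_; tail; updateAt)
open import Data.Vec.Functional.Properties using (updateAt-updates; updateAt-minimal)
open import Data.Vec.Functional.Relation.Binary.Pointwise using (Pointwise)
open import Data.Bool using (Bool; true; false)
open import Data.Product using (_×_; _,_; proj₁; proj₂; ∃)
open import Data.List as List using (List; []; _++_; map; filter; concatMap; allFin)
import Data.List.Properties as Listₚ
import Data.List.Relation.Unary.All as All
open import Function using (_∘_; _⇔_; mk⇔; Equivalence)
open import Relation.Nullary using (¬_; ¬?; Dec; yes; no; does; contradiction; _×-dec_)
open import Relation.Unary using (Pred; Decidable)
open import Relation.Binary.PropositionalEquality as ≡ using (_≡_; _≢_; _≗_; refl; cong; cong₂)
import Relation.Binary.Reasoning.Setoid as SetoidReasoning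
open import Algebra.Bundles using (CommutativeRing)
open import Algebra.Structures using (IsCommutativeRing)
import Algebra.Properties.CommutativeSemigroup as CommutativeSemigroupProperties
import Algebra.Properties.Ring as RingProperties

≡suc⇒≢0 : ∀ {x k} → x ≡ suc k → x ≢ 0
≡suc⇒≢0 refl ()

sumℕ-cong : ∀ n {r r′ : Fin n → ℕ} → r ≗ r′ → sumℕ n r ≡ sumℕ n r′
sumℕ-cong zero    eq = refl
sumℕ-cong (suc n) eq = cong₂ _+_ (eq zero) (sumℕ-cong n (eq ∘ suc))

sumℕ-mono : ∀ n {r r′ : Fin n → ℕ} → Pointwise _≤_ r r′ → sumℕ n r ≤ sumℕ n r′
sumℕ-mono zero    le = z≤n
sumℕ-mono (suc n) le = +-mono-≤ (le zero) (sumℕ-mono n (le ∘ suc))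

sumℕ≡0⇒≡0 : ∀ n (r : Fin n → ℕ) → sumℕ n r ≡ 0 → r ≗ (λ _ → 0)
sumℕ≡0⇒≡0 (suc n) r eq zero    = m+n≡0⇒m≡0 (r zero) eq
sumℕ≡0⇒≡0 (suc n) r eq (suc j) = sumℕ≡0⇒≡0 n (tail r) (m+n≡0⇒n≡0 (r zero) eq) j

sumℕ-updateAt-pred : ∀ n (r : Fin n → ℕ) b {k} → r b ≡ suc k →
                     suc (sumℕ n (updateAt r b pred)) ≡ sumℕ n r
sumℕ-updateAt-pred (suc n) r zero    eq rewrite eq = refl
sumℕ-updateAt-pred (suc n) r (suc b) eq =
  ≡.trans (≡.sym (+-suc (r zero) _)) (cong (r zero +_) (sumℕ-updateAt-pred n (tail r) b eq))

sumℕ-const : ∀ n a → sumℕ n (λ _ → a) ≡ n * a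
sumℕ-const zero    a = refl
sumℕ-const (suc n) a = cong (a +_) (sumℕ-const n a)

updateAt-pred-≤ : ∀ {n} {r m : Fin n → ℕ} → Pointwise _≤_ r m → ∀ b → Pointwise _≤_ (updateAt r b pred) m
updateAt-pred-≤ {r = r} le b j with b Finₚ.≟ j
... | yes refl = ≤-trans (≤-reflexive (updateAt-updates b r)) (≤-trans pred[n]≤n (le b))
... | no b≢j   = ≤-trans (≤-reflexive (updateAt-minimal j b r (b≢j ∘ ≡.sym))) (le j)

-- The box 0 ≤ r ≤ m in mixed radix

boxSize : ∀ n → (Fin n → ℕ) → ℕ
boxSize n m = prodℕ n (λ i → m i + 1)

boxSize-ones : ∀ n → boxSize n (λ _ → 1) ≤ 3 ^ n
boxSize-ones zero    = ≤-refl
boxSize-ones (suc n) = *-mono-≤ {2} {3} (s≤s (s≤s z≤n)) (boxSize-ones n)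

digit : ∀ a b → Fin (a + 1)
digit a b = Fin.fromℕ< (≤-<-trans (m∸n≤m a b) (m<m+n a (s≤s z≤n)))

toℕ-digit : ∀ a b → toℕ (digit a b) ≡ a ∸ b
toℕ-digit a b = Finₚ.toℕ-fromℕ< _

-- The digit of coordinate i is m i ∸ r i, so that the corner m gets index 0,
-- the corner 0 the last index, and lowering any coordinate raises the index.
encode : ∀ {n} (m r : Fin n → ℕ) → Fin (boxSize n m)
encode {zero}  m r = zero
encode {suc n} m r = combine (digit (m zero) (r zero)) (encode (tail m) (tail r))

decode : ∀ {n} (m : Fin n → ℕ) → Fin (boxSize n m) → Fin n → ℕ
decode {zero}  m u ()
decode {suc n} m u =
  let (q , u′) = remQuot {m zero + 1} (boxSize n (tail m)) u in (m zero ∸ toℕ q) ∷ decode (tail m) u′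

decode-encode : ∀ {n} (m r : Fin n → ℕ) → Pointwise _≤_ r m → decode m (encode m r) ≗ r
decode-encode {suc n} m r r≤m zero = begin
  m zero ∸ toℕ (proj₁ (remQuot {m zero + 1} _ (combine d (encode (tail m) (tail r)))))
    ≡⟨ cong (λ p → m zero ∸ toℕ (proj₁ p)) (Finₚ.remQuot-combine d _) ⟩
  m zero ∸ toℕ d   ≡⟨ cong (m zero ∸_) (toℕ-digit (m zero) (r zero)) ⟩
  m zero ∸ (m zero ∸ r zero) ≡⟨ m∸[m∸n]≡n (r≤m zero) ⟩
  r zero ∎
  where
  open ≡.≡-Reasoning
  d : Fin (m zero + 1)
  d = digit (m zero) (r zero)
decode-encode {suc n} m r r≤m (suc j) =
  ≡.trans (cong (λ p → decode (tail m) (proj₂ p) j) (Finₚ.remQuot-combine (digit (m zero) (r zero)) _))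
          (decode-encode (tail m) (tail r) (r≤m ∘ suc) j)

decode-≤ : ∀ {n} (m : Fin n → ℕ) u → Pointwise _≤_ (decode m u) m
decode-≤ {suc n} m u zero    = m∸n≤m (m zero) (toℕ (proj₁ (remQuot {m zero + 1} (boxSize n (tail m)) u)))
decode-≤ {suc n} m u (suc j) = decode-≤ (tail m) _ j

encode-decode : ∀ {n} (m : Fin n → ℕ) u → encode m (decode m u) ≡ u
encode-decode {zero}  m zero = refl
encode-decode {suc n} m u = begin
  combine (digit (m zero) (m zero ∸ toℕ q)) (encode (tail m) (decode (tail m) u′))
    ≡⟨ cong₂ combine digit-q (encode-decode (tail m) u′) ⟩
  combine q u′
    ≡⟨ Finₚ.combine-remQuot {m zero + 1} (boxSize n (tail m)) u ⟩
  u ∎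
  where
  open ≡.≡-Reasoning
  q : Fin (m zero + 1)
  q = proj₁ (remQuot {m zero + 1} (boxSize n (tail m)) u)
  u′ : Fin (boxSize n (tail m))
  u′ = proj₂ (remQuot {m zero + 1} (boxSize n (tail m)) u)
  q≤m : toℕ q ≤ m zero
  q≤m = ≤-pred (≤-trans (Finₚ.toℕ<n q) (≤-reflexive (ℕₚ.+-comm (m zero) 1)))
  digit-q : digit (m zero) (m zero ∸ toℕ q) ≡ q
  digit-q = Finₚ.toℕ-injective (≡.trans (toℕ-digit (m zero) (m zero ∸ toℕ q)) (m∸[m∸n]≡n q≤m))

encode-cong : ∀ {n} (m : Fin n → ℕ) {r r′} → r ≗ r′ → encode m r ≡ encode m r′
encode-cong {zero}  m eq = refl
encode-cong {suc n} m eq = cong₂ combine (cong (digit (m zero)) (eq zero)) (encode-cong (tail m) (eq ∘ suc))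

toℕ-encode-top : ∀ {n} (m : Fin n → ℕ) → toℕ (encode m m) ≡ 0
toℕ-encode-top {zero}  m = refl
toℕ-encode-top {suc n} m
  rewrite Finₚ.toℕ-combine (digit (m zero) (m zero)) (encode (tail m) (tail m))
        | toℕ-digit (m zero) (m zero) | n∸n≡0 (m zero) | toℕ-encode-top (tail m)
  = ≡.trans (ℕₚ.+-identityʳ _) (*-zeroʳ (boxSize n (tail m)))

suc-toℕ-encode-bottom : ∀ {n} (m : Fin n → ℕ) → suc (toℕ (encode m (λ _ → 0))) ≡ boxSize n m
suc-toℕ-encode-bottom {zero}  m = refl
suc-toℕ-encode-bottom {suc n} m
  rewrite Finₚ.toℕ-combine (digit (m zero) 0) (encode (tail m) (λ _ → 0)) | toℕ-digit (m zero) 0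
  = begin
    suc (B * m zero + t)  ≡⟨ +-suc (B * m zero) t ⟨
    B * m zero + suc t    ≡⟨ cong (B * m zero +_) (suc-toℕ-encode-bottom (tail m)) ⟩
    B * m zero + B        ≡⟨ cong₂ _+_ (ℕₚ.*-comm (m zero) B) (ℕₚ.*-identityˡ B) ⟨
    m zero * B + 1 * B    ≡⟨ *-distribʳ-+ B (m zero) 1 ⟨
    (m zero + 1) * B      ∎
  where
  open ≡.≡-Reasoning
  B t : ℕ
  B = boxSize n (tail m)
  t = toℕ (encode (tail m) (λ _ → 0))

encode-updateAt-pred : ∀ {n} (m r : Fin n → ℕ) → Pointwise _≤_ r m → ∀ b {k} → r b ≡ suc k →
                       toℕ (encode m r) < toℕ (encode m (updateAt r b pred))
encode-updateAt-pred {suc n} m r r≤m zero {k} eq =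
  Finₚ.combine-monoˡ-< (encode (tail m) (tail r)) _ digit-<
  where
  digit-< : toℕ (digit (m zero) (r zero)) < toℕ (digit (m zero) (pred (r zero)))
  digit-< rewrite toℕ-digit (m zero) (r zero) | toℕ-digit (m zero) (pred (r zero)) | eq =
    ∸-monoʳ-< (n<1+n k) (≤-trans (≤-reflexive (≡.sym eq)) (r≤m zero))
encode-updateAt-pred {suc n} m r r≤m (suc b) eq
  rewrite Finₚ.toℕ-combine (digit (m zero) (r zero)) (encode (tail m) (tail r))
        | Finₚ.toℕ-combine (digit (m zero) (r zero)) (encode (tail m) (updateAt (tail r) b pred))
  = +-monoʳ-< _ (encode-updateAt-pred (tail m) (tail r) (r≤m ∘ suc) b eq)

fibreSize-head : ∀ {t n} (σ : Fin (suc t) → Fin n) →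
                 fibreSize σ (σ zero) ≡ suc (fibreSize (tail σ) (σ zero))
fibreSize-head σ with σ zero Finₚ.≟ σ zero
... | yes _   = refl
... | no σ₀≢σ₀ = contradiction refl σ₀≢σ₀

fibreSize-¬head : ∀ {t n} (σ : Fin (suc t) → Fin n) {j} → σ zero ≢ j →
                  fibreSize σ j ≡ fibreSize (tail σ) j
fibreSize-¬head σ {j} σ₀≢j with σ zero Finₚ.≟ j
... | yes σ₀≡j = contradiction σ₀≡j σ₀≢j
... | no _     = refl

fibreSize-tail-≤ : ∀ {t n} (σ : Fin (suc t) → Fin n) j → fibreSize (tail σ) j ≤ fibreSize σ j
fibreSize-tail-≤ σ j with σ zero Finₚ.≟ j
... | yes _ = n≤1+n _
... | no _  = ≤-refl

fibreSize-cong : ∀ {t n} {σ σ′ : Fin t → Fin n} → σ ≗ σ′ → fibreSize σ ≗ fibreSize σ′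
fibreSize-cong {zero}  σ≗σ′ j = refl
fibreSize-cong {suc t} {σ = σ} {σ′} σ≗σ′ j with σ zero Finₚ.≟ j | σ′ zero Finₚ.≟ j
... | yes _    | yes _    = cong suc (fibreSize-cong (σ≗σ′ ∘ suc) j)
... | no _     | no _     = fibreSize-cong (σ≗σ′ ∘ suc) j
... | yes σ₀≡j | no σ′₀≢j = contradiction (≡.trans (≡.sym (σ≗σ′ zero)) σ₀≡j) σ′₀≢j
... | no σ₀≢j  | yes σ′₀≡j = contradiction (≡.trans (σ≗σ′ zero) σ′₀≡j) σ₀≢j

fibreSize-≡0 : ∀ {t n} (σ : Fin t → Fin n) j → (∀ i → σ i ≢ j) → fibreSize σ j ≡ 0
fibreSize-≡0 {zero}  σ j j∉σ = refl
fibreSize-≡0 {suc t} σ j j∉σ = ≡.trans (fibreSize-¬head σ (j∉σ zero)) (fibreSize-≡0 (tail σ) j (j∉σ ∘ suc))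

fibreSize-≥1 : ∀ {t n} (σ : Fin t → Fin n) i → 1 ≤ fibreSize σ (σ i)
fibreSize-≥1 σ zero    = ≤-trans (s≤s z≤n) (≤-reflexive (≡.sym (fibreSize-head σ)))
fibreSize-≥1 σ (suc i) = ≤-trans (fibreSize-≥1 (tail σ) i) (fibreSize-tail-≤ σ (σ (suc i)))

fibreSize-≥2 : ∀ {t n} (σ : Fin t → Fin n) {i i′} → i ≢ i′ → σ i ≡ σ i′ → 2 ≤ fibreSize σ (σ i)
fibreSize-≥2 σ {zero}  {zero}   i≢i′ _  = contradiction refl i≢i′
fibreSize-≥2 σ {zero}  {suc i′} _    eq = begin
  2                                   ≤⟨ s≤s (fibreSize-≥1 (tail σ) i′) ⟩
  suc (fibreSize (tail σ) (σ (suc i′))) ≡⟨ cong (suc ∘ fibreSize (tail σ)) eq ⟨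
  suc (fibreSize (tail σ) (σ zero))     ≡⟨ fibreSize-head σ ⟨
  fibreSize σ (σ zero)                  ∎
  where open ≤-Reasoning
fibreSize-≥2 σ {suc i} {zero}   i≢i′ eq =
  ≡.subst (λ x → 2 ≤ fibreSize σ x) (≡.sym eq) (fibreSize-≥2 σ (i≢i′ ∘ ≡.sym) (≡.sym eq))
fibreSize-≥2 σ {suc i} {suc i′} i≢i′ eq =
  ≤-trans (fibreSize-≥2 (tail σ) (i≢i′ ∘ cong suc) eq) (fibreSize-tail-≤ σ (σ (suc i)))

fibreSize-injective : ∀ {t n} (σ : Fin t → Fin n) → (∀ i i′ → σ i ≡ σ i′ → i ≡ i′) →
                      ∀ j → fibreSize σ j ≤ 1
fibreSize-injective {zero}  σ inj j = z≤n
fibreSize-injective {suc t} σ inj j with σ zero Finₚ.≟ j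
... | yes refl =
  s≤s (≤-reflexive (fibreSize-≡0 (tail σ) (σ zero) (λ i eq → Finₚ.0≢1+n (inj zero (suc i) (≡.sym eq)))))
... | no _     = fibreSize-injective (tail σ) (λ i i′ eq → Finₚ.suc-injective (inj (suc i) (suc i′) eq)) j

-- Pigeonhole: a non-surjective σ would inject Fin (suc n) into Fin n after punching out the missed value.
IsPerm⇒surjective : ∀ {n} (σ : Fin n → Fin n) → IsPerm σ → ∀ j → ∃ λ i → σ i ≡ j
IsPerm⇒surjective {suc n} σ inj j with Finₚ.any? (λ i → σ i Finₚ.≟ j)
... | yes j∈σ = j∈σ
... | no  j∉σ = contradiction (Finₚ.injective⇒≤ punchOut-injective) 1+n≰n
  where
  punchOut-injective : ∀ {i i′} → Fin.punchOut (λ eq → j∉σ (i , ≡.sym eq)) ≡ Fin.punchOut (λ eq → j∉σ (i′ , ≡.sym eq)) →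
                       i ≡ i′
  punchOut-injective {i} {i′} eq =
    inj i i′ (Finₚ.punchOut-injective (λ eq → j∉σ (i , ≡.sym eq)) (λ eq → j∉σ (i′ , ≡.sym eq)) eq)

IsPerm⇒HasFibres-ones : ∀ {n} (σ : Fin n → Fin n) → IsPerm σ → HasFibres (λ _ → 1) σ
IsPerm⇒HasFibres-ones σ inj j with IsPerm⇒surjective σ inj j
... | i , refl = ≤-antisym (fibreSize-injective σ inj (σ i)) (fibreSize-≥1 σ i)

HasFibres-ones⇒IsPerm : ∀ {n} (σ : Fin n → Fin n) → HasFibres (λ _ → 1) σ → IsPerm σ
HasFibres-ones⇒IsPerm σ ones i i′ eq with i Finₚ.≟ i′
... | yes i≡i′ = i≡i′
... | no  i≢i′ = contradiction (≤-trans (fibreSize-≥2 σ i≢i′ eq) (≤-reflexive (ones (σ i)))) (λ { (s≤s ()) })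

HasFibres-∷ : ∀ {t n} {r : Fin n → ℕ} {b} {τ : Fin t → Fin n} →
              HasFibres r (b ∷ τ) ⇔ (r b ≢ 0 × HasFibres (updateAt r b pred) τ)
HasFibres-∷ {r = r} {b} {τ} = mk⇔ to from
  where
  head-fibre : HasFibres r (b ∷ τ) → suc (fibreSize τ b) ≡ r b
  head-fibre hf = ≡.trans (≡.sym (fibreSize-head (b ∷ τ))) (hf b)

  to : HasFibres r (b ∷ τ) → r b ≢ 0 × HasFibres (updateAt r b pred) τ
  to hf = ≡suc⇒≢0 (≡.sym (head-fibre hf)) , tail-fibres
    where
    tail-fibres : HasFibres (updateAt r b pred) τ
    tail-fibres j with b Finₚ.≟ j
    ... | yes refl = ≡.trans (cong pred (head-fibre hf)) (≡.sym (updateAt-updates b r))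
    ... | no b≢j   = ≡.trans (≡.sym (fibreSize-¬head (b ∷ τ) b≢j))
                             (≡.trans (hf j) (≡.sym (updateAt-minimal j b r (b≢j ∘ ≡.sym))))

  from : r b ≢ 0 × HasFibres (updateAt r b pred) τ → HasFibres r (b ∷ τ)
  from (rb≢0 , hf) j with b Finₚ.≟ j
  ... | yes refl = ≡.trans (cong suc (≡.trans (hf j) (updateAt-updates j r)))
                           (suc-pred (r j) {{ℕ.≢-nonZero rb≢0}})
  ... | no b≢j   = ≡.trans (hf j) (updateAt-minimal j b r (b≢j ∘ ≡.sym))

filter-map : ∀ {A B : Set} {p} {P : Pred B p} (P? : Decidable P) (f : A → B) xs →
             filter P? (map f xs) ≡ map f (filter (P? ∘ f) xs)
filter-map P? f []       = refl
filter-map P? f (x List.∷ xs) with does (P? (f x))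
... | true  = cong (f x List.∷_) (filter-map P? f xs)
... | false = filter-map P? f xs

filter-concatMap : ∀ {A B : Set} {p} {P : Pred B p} (P? : Decidable P) (F : A → List B) xs →
                   filter P? (concatMap F xs) ≡ concatMap (filter P? ∘ F) xs
filter-concatMap P? F []            = refl
filter-concatMap P? F (x List.∷ xs) =
  ≡.trans (Listₚ.filter-++ P? (F x) _) (cong (filter P? (F x) ++_) (filter-concatMap P? F xs))

module _ {c ℓ : Level} (k : Field c ℓ) where
  open Polys k
  private module K = Field k

  Poly-isCommutativeRing : (V : Set) →
    IsCommutativeRing (_≈ₚ_ {V}) _⊕_ _⊗_ (con (K.- K.1#) ⊗_) (con K.0#) (con K.1#)
  Poly-isCommutativeRing V = record
    { isRing = record
      { +-isAbelianGroup = record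
        { isGroup = record
          { isMonoid = record
            { isSemigroup = record
              { isMagma = record
                { isEquivalence = record { refl = ≈-refl ; sym = ≈-sym ; trans = ≈-trans }
                ; ∙-cong = p⊕-cong }
              ; assoc = p⊕-assoc }
            ; identity = p⊕-identity , λ p → ≈-trans (p⊕-comm p _) (p⊕-identity p) }
          ; inverse = (λ p → ≈-trans (p⊕-comm _ p) (p⊕-inverse p)) , p⊕-inverse
          ; ⁻¹-cong = p⊗-cong ≈-refl }
        ; comm = p⊕-comm }
      ; *-cong = p⊗-cong
      ; *-assoc = p⊗-assoc
      ; *-identity = p⊗-identity , λ p → ≈-trans (p⊗-comm p _) (p⊗-identity p)
      ; distrib = p-distrib , λ p q r → ≈-trans (p⊗-comm _ p)
                                        (≈-trans (p-distrib p q r) (p⊕-cong (p⊗-comm p q) (p⊗-comm p r))) }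
    ; *-comm = p⊗-comm }

  Poly-commutativeRing : Set → CommutativeRing c (c ⊔ ℓ)
  Poly-commutativeRing V = record { isCommutativeRing = Poly-isCommutativeRing V }

  module PolyRing (V : Set) where
    open CommutativeRing (Poly-commutativeRing V) public
      using (setoid; +-commutativeSemigroup; +-assoc; +-identityˡ; +-identityʳ; *-assoc; *-comm;
             *-identityˡ; zeroˡ; zeroʳ; distribˡ; distribʳ)
    open CommutativeSemigroupProperties +-commutativeSemigroup public using (interchange)
    open SetoidReasoning setoid public

  module _ {V : Set} where
    open PolyRing V

    ≡⇒≈ₚ : {p q : Poly V} → p ≡ q → p ≈ₚ q
    ≡⇒≈ₚ refl = ≈-refl

    Σᶠ-cong : ∀ n {f g : Fin n → Poly V} → (∀ i → f i ≈ₚ g i) → Σᶠ n f ≈ₚ Σᶠ n g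
    Σᶠ-cong zero    eq = ≈-refl
    Σᶠ-cong (suc n) eq = p⊕-cong (eq zero) (Σᶠ-cong n (eq ∘ suc))

    Πᶠ-cong : ∀ n {f g : Fin n → Poly V} → (∀ i → f i ≈ₚ g i) → Πᶠ n f ≈ₚ Πᶠ n g
    Πᶠ-cong zero    eq = ≈-refl
    Πᶠ-cong (suc n) eq = p⊗-cong (eq zero) (Πᶠ-cong n (eq ∘ suc))

    Σᶠ-zero : ∀ n {f : Fin n → Poly V} → (∀ i → f i ≈ₚ con K.0#) → Σᶠ n f ≈ₚ con K.0#
    Σᶠ-zero zero    eq = ≈-refl
    Σᶠ-zero (suc n) eq = ≈-trans (p⊕-cong (eq zero) (Σᶠ-zero n (eq ∘ suc))) (+-identityˡ _)

    Σᶠ-distrib-⊕ : ∀ n (f g : Fin n → Poly V) → Σᶠ n (λ i → f i ⊕ g i) ≈ₚ Σᶠ n f ⊕ Σᶠ n g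
    Σᶠ-distrib-⊕ zero    f g = ≈-sym (+-identityˡ _)
    Σᶠ-distrib-⊕ (suc n) f g =
      ≈-trans (p⊕-cong ≈-refl (Σᶠ-distrib-⊕ n (f ∘ suc) (g ∘ suc))) (interchange _ _ _ _)

    Σᶠ-distribʳ-⊗ : ∀ n (f : Fin n → Poly V) p → Σᶠ n f ⊗ p ≈ₚ Σᶠ n (λ i → f i ⊗ p)
    Σᶠ-distribʳ-⊗ zero    f p = zeroˡ p
    Σᶠ-distribʳ-⊗ (suc n) f p = ≈-trans (distribʳ p _ _) (p⊕-cong ≈-refl (Σᶠ-distribʳ-⊗ n (f ∘ suc) p))

    Σᶠ-comm : ∀ n m (f : Fin n → Fin m → Poly V) →
              Σᶠ n (λ i → Σᶠ m (f i)) ≈ₚ Σᶠ m (λ j → Σᶠ n (λ i → f i j))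
    Σᶠ-comm zero    m f = ≈-sym (Σᶠ-zero m (λ _ → ≈-refl))
    Σᶠ-comm (suc n) m f =
      ≈-trans (p⊕-cong ≈-refl (Σᶠ-comm n m (f ∘ suc))) (≈-sym (Σᶠ-distrib-⊕ m (f zero) _))

    Σᶠ-single : ∀ n (f : Fin n → Poly V) i → (∀ j → j ≢ i → f j ≈ₚ con K.0#) → Σᶠ n f ≈ₚ f i
    Σᶠ-single (suc n) f zero    off =
      ≈-trans (p⊕-cong ≈-refl (Σᶠ-zero n (λ j → off (suc j) λ ()))) (+-identityʳ _)
    Σᶠ-single (suc n) f (suc i) off =
      ≈-trans (p⊕-cong (off zero λ ())
                       (Σᶠ-single n (f ∘ suc) i (λ j j≢i → off (suc j) (j≢i ∘ Finₚ.suc-injective))))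
              (+-identityˡ _)

    sumL-++ : ∀ (ps qs : List (Poly V)) → sumL (ps ++ qs) ≈ₚ sumL ps ⊕ sumL qs
    sumL-++ []            qs = ≈-sym (+-identityˡ _)
    sumL-++ (p List.∷ ps) qs = ≈-trans (p⊕-cong ≈-refl (sumL-++ ps qs)) (≈-sym (+-assoc _ _ _))

    sumL-concatMap : ∀ {A : Set} (F : A → List (Poly V)) xs →
                     sumL (concatMap F xs) ≈ₚ sumL (map (sumL ∘ F) xs)
    sumL-concatMap F []            = ≈-refl
    sumL-concatMap F (x List.∷ xs) = ≈-trans (sumL-++ (F x) _) (p⊕-cong ≈-refl (sumL-concatMap F xs))

    sumL-map-cong : ∀ {A : Set} {f g : A → Poly V} → (∀ x → f x ≈ₚ g x) → ∀ xs →
                    sumL (map f xs) ≈ₚ sumL (map g xs)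
    sumL-map-cong eq []            = ≈-refl
    sumL-map-cong eq (x List.∷ xs) = p⊕-cong (eq x) (sumL-map-cong eq xs)

    sumL-map-⊗ˡ : ∀ {A : Set} p (f : A → Poly V) xs → sumL (map (λ x → p ⊗ f x) xs) ≈ₚ p ⊗ sumL (map f xs)
    sumL-map-⊗ˡ p f []            = ≈-sym (zeroʳ p)
    sumL-map-⊗ˡ p f (x List.∷ xs) = ≈-trans (p⊕-cong ≈-refl (sumL-map-⊗ˡ p f xs)) (≈-sym (distribˡ p _ _))

    sumL-map-⊗ʳ : ∀ {A : Set} (f : A → Poly V) p xs → sumL (map (λ x → f x ⊗ p) xs) ≈ₚ sumL (map f xs) ⊗ p
    sumL-map-⊗ʳ f p []            = ≈-sym (zeroˡ p)
    sumL-map-⊗ʳ f p (x List.∷ xs) = ≈-trans (p⊕-cong ≈-refl (sumL-map-⊗ʳ f p xs)) (≈-sym (distribʳ p _ _))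

    sumL-allFin : ∀ n (f : Fin n → Poly V) → sumL (map f (allFin n)) ≈ₚ Σᶠ n f
    sumL-allFin n f = ≈-trans (≡⇒≈ₚ (cong sumL (Listₚ.map-tabulate (λ i → i) f))) (sumL-tabulate n f)
      where
      sumL-tabulate : ∀ n (f : Fin n → Poly V) → sumL (List.tabulate f) ≈ₚ Σᶠ n f
      sumL-tabulate zero    f = ≈-refl
      sumL-tabulate (suc n) f = p⊕-cong ≈-refl (sumL-tabulate n (f ∘ suc))

    -- allFuns (suc a) bs prepends each b to every element of allFuns a bs, through an anonymous
    -- function that agrees with b ∷_ only pointwise; hence the extensionality hypotheses.
    sumL-allFuns-suc : ∀ {B : Set} a (bs : List B) (g : (Fin (suc a) → B) → Poly V) →
      (∀ {σ σ′} → σ ≗ σ′ → g σ ≈ₚ g σ′) →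
      sumL (map g (allFuns (suc a) bs)) ≈ₚ sumL (map (λ b → sumL (map (g ∘ (b ∷_)) (allFuns a bs))) bs)
    sumL-allFuns-suc a bs g g-ext =
      ≈-trans (≡⇒≈ₚ (cong sumL (Listₚ.map-concatMap g _ bs)))
              (≈-trans (sumL-concatMap _ bs) (sumL-map-cong cons-terms bs))
      where
      cons-terms : ∀ b → sumL (map g (map _ (allFuns a bs))) ≈ₚ sumL (map (g ∘ (b ∷_)) (allFuns a bs))
      cons-terms b = ≈-trans (≡⇒≈ₚ (cong sumL (≡.sym (Listₚ.map-∘ (allFuns a bs)))))
                             (sumL-map-cong (λ τ → g-ext λ { zero → refl ; (suc i) → refl }) (allFuns a bs))

    sumL-filter-allFuns-suc : ∀ {B : Set} {p} a (bs : List B) {P : Pred (Fin (suc a) → B) p} (P? : Decidable P) →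
      (∀ {σ σ′} → σ ≗ σ′ → P σ → P σ′) →
      (g : (Fin (suc a) → B) → Poly V) → (∀ {σ σ′} → σ ≗ σ′ → g σ ≈ₚ g σ′) →
      sumL (map g (filter P? (allFuns (suc a) bs))) ≈ₚ
      sumL (map (λ b → sumL (map (g ∘ (b ∷_)) (filter (P? ∘ (b ∷_)) (allFuns a bs)))) bs)
    sumL-filter-allFuns-suc a bs P? P-ext g g-ext =
      ≈-trans (≡⇒≈ₚ (cong sumL (≡.trans (cong (map g) (filter-concatMap P? _ bs)) (Listₚ.map-concatMap g _ bs))))
              (≈-trans (sumL-concatMap _ bs) (sumL-map-cong cons-terms bs))
      where
      cons-terms : ∀ b → sumL (map g (filter P? (map _ (allFuns a bs)))) ≈ₚ
                         sumL (map (g ∘ (b ∷_)) (filter (P? ∘ (b ∷_)) (allFuns a bs)))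
      cons-terms b = ≈-trans (≡⇒≈ₚ (cong sumL (≡.trans (cong (map g) (filter-map P? _ (allFuns a bs)))
                                                       (≡.sym (Listₚ.map-∘ _)))))
                    (≈-trans (sumL-map-cong (λ τ → g-ext λ { zero → refl ; (suc i) → refl }) _)
                             (≡⇒≈ₚ (cong (sumL ∘ map (g ∘ (b ∷_))) (Listₚ.filter-≐ _ _
                               (P-ext (λ { zero → refl ; (suc i) → refl }) ,
                                P-ext (λ { zero → refl ; (suc i) → refl }))
                               (allFuns a bs)))))

    sumL-allFuns-Πᶠ : ∀ {B : Set} n (bs : List B) (a : Fin n → B → Poly V) →
      sumL (map (λ ε → Πᶠ n (λ i → a i (ε i))) (allFuns n bs)) ≈ₚ Πᶠ n (λ i → sumL (map (a i) bs))
    sumL-allFuns-Πᶠ zero    bs a = +-identityʳ _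
    sumL-allFuns-Πᶠ (suc n) bs a = begin
      sumL (map (λ ε → Πᶠ (suc n) (λ i → a i (ε i))) (allFuns (suc n) bs))
        ≈⟨ sumL-allFuns-suc n bs _ (λ eq → Πᶠ-cong (suc n) (λ i → ≡⇒≈ₚ (cong (a i) (eq i)))) ⟩
      sumL (map (λ b → sumL (map (λ τ → a zero b ⊗ Πᶠ n (λ i → a (suc i) (τ i))) (allFuns n bs))) bs)
        ≈⟨ sumL-map-cong (λ b → ≈-trans (sumL-map-⊗ˡ (a zero b) _ (allFuns n bs))
                                         (p⊗-cong ≈-refl (sumL-allFuns-Πᶠ n bs (a ∘ suc)))) bs ⟩
      sumL (map (λ b → a zero b ⊗ Πᶠ n (λ i → sumL (map (a (suc i)) bs))) bs)
        ≈⟨ sumL-map-⊗ʳ (a zero) _ bs ⟩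
      sumL (map (a zero) bs) ⊗ Πᶠ n (λ i → sumL (map (a (suc i)) bs)) ∎

    det-zero-column : ∀ m (A : Fin m → Fin m → Poly V) j → (∀ i → A i j ≈ₚ con K.0#) → det m A ≈ₚ con K.0#
    det-zero-column (suc m) A j zero-col = Σᶠ-zero (suc m) term
      where
      term : ∀ l → con (sgn (toℕ l)) ⊗ A zero l ⊗ det m (λ i l′ → A (suc i) (Fin.punchIn l l′)) ≈ₚ con K.0#
      term l with l Finₚ.≟ j
      ... | yes refl = ≈-trans (p⊗-cong (≈-trans (p⊗-cong ≈-refl (zero-col zero)) (zeroʳ _)) ≈-refl) (zeroˡ _)
      ... | no l≢j   = ≈-trans (p⊗-cong ≈-refl minor-zero) (zeroʳ _)
        where
        minor-zero : det m (λ i l′ → A (suc i) (Fin.punchIn l l′)) ≈ₚ con K.0#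
        minor-zero = det-zero-column m _ (Fin.punchOut l≢j)
          (λ i → ≈-trans (≡⇒≈ₚ (cong (A (suc i)) (Finₚ.punchIn-punchOut l≢j))) (zero-col (suc i)))

    det-column₀ : ∀ m (A : Fin (suc m) → Fin (suc m) → Poly V) → (∀ i → A (suc i) zero ≈ₚ con K.0#) →
                  det (suc m) A ≈ₚ A zero zero ⊗ det m (λ i l → A (suc i) (suc l))
    det-column₀ m A zero-col = begin
      det (suc m) A
        ≈⟨ p⊕-cong ≈-refl (Σᶠ-zero m (λ j →
             ≈-trans (p⊗-cong ≈-refl (minor-zero A zero-col j)) (zeroʳ _))) ⟩
      con K.1# ⊗ A zero zero ⊗ det m (λ i l → A (suc i) (suc l)) ⊕ con K.0#
        ≈⟨ ≈-trans (+-identityʳ _) (p⊗-cong (*-identityˡ _) ≈-refl) ⟩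
      A zero zero ⊗ det m (λ i l → A (suc i) (suc l)) ∎
      where
      minor-zero : ∀ {m} (A : Fin (suc m) → Fin (suc m) → Poly V) → (∀ i → A (suc i) zero ≈ₚ con K.0#) →
                   ∀ j → det m (λ i l → A (suc i) (Fin.punchIn (suc j) l)) ≈ₚ con K.0#
      minor-zero {suc m} A zero-col j = det-zero-column (suc m) (λ i l → A (suc i) (Fin.punchIn (suc j) l)) zero zero-col

    -- Multipermanents of row families

    mpermRows : ∀ {n} t → (Fin n → ℕ) → (ℕ → Fin n → Poly V) → Poly V
    mpermRows t r h = sumL (map (λ σ → Πᶠ t (λ i → h (toℕ i) (σ i))) (Σₘ t r))

    whenNonZero : ℕ → Poly V → Poly V
    whenNonZero zero    p = con K.0#
    whenNonZero (suc _) p = p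

    mpermRows-cong : ∀ {n} t {r r′ : Fin n → ℕ} {h h′ : ℕ → Fin n → Poly V} →
                     r ≗ r′ → (∀ k j → h k j ≈ₚ h′ k j) → mpermRows t r h ≈ₚ mpermRows t r′ h′
    mpermRows-cong {n} t {r} {r′} {h} {h′} r≗r′ h≈h′ = begin
      sumL (map _ (filter (hasFibres? r) (allFuns t (allFin n))))
        ≡⟨ cong (sumL ∘ map _) (Listₚ.filter-≐ (hasFibres? r) (hasFibres? r′)
             ((λ hf j → ≡.trans (hf j) (r≗r′ j)) , (λ hf j → ≡.trans (hf j) (≡.sym (r≗r′ j))))
             (allFuns t (allFin n))) ⟩
      sumL (map _ (filter (hasFibres? r′) (allFuns t (allFin n))))
        ≈⟨ sumL-map-cong (λ σ → Πᶠ-cong t (λ i → h≈h′ (toℕ i) (σ i))) _ ⟩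
      mpermRows t r′ h′ ∎

    mpermRows-zero : ∀ {n} {r : Fin n → ℕ} h → r ≗ (λ _ → 0) → mpermRows 0 r h ≈ₚ con K.1#
    mpermRows-zero {r = r} h r≗0 =
      ≈-trans (≡⇒≈ₚ (cong (sumL ∘ map _) (Listₚ.filter-accept (hasFibres? r) (≡.sym ∘ r≗0)))) (+-identityʳ _)

    mpermRows-suc : ∀ {n} t (r : Fin n → ℕ) h →
      mpermRows (suc t) r h ≈ₚ Σᶠ n (λ b → whenNonZero (r b) (h 0 b ⊗ mpermRows t (updateAt r b pred) (h ∘ suc)))
    mpermRows-suc {n} t r h = begin
      mpermRows (suc t) r h
        ≈⟨ sumL-filter-allFuns-suc t (allFin n) (hasFibres? r) HasFibres-ext _
             (λ eq → Πᶠ-cong (suc t) (λ i → ≡⇒≈ₚ (cong (h (toℕ i)) (eq i)))) ⟩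
      sumL (map first-row (allFin n))
        ≈⟨ sumL-allFin n first-row ⟩
      Σᶠ n first-row
        ≈⟨ Σᶠ-cong n expand ⟩
      Σᶠ n (λ b → whenNonZero (r b) (h 0 b ⊗ mpermRows t (updateAt r b pred) (h ∘ suc))) ∎
      where
      rest : (Fin t → Fin n) → Poly V
      rest τ = Πᶠ t (λ i → h (suc (toℕ i)) (τ i))
      first-row : Fin n → Poly V
      first-row b = sumL (map (λ τ → h 0 b ⊗ rest τ) (filter (hasFibres? r ∘ (b ∷_)) (allFuns t (allFin n))))
      HasFibres-ext : ∀ {σ σ′ : Fin (suc t) → Fin n} → σ ≗ σ′ → HasFibres r σ → HasFibres r σ′
      HasFibres-ext σ≗σ′ hf j = ≡.trans (≡.sym (fibreSize-cong σ≗σ′ j)) (hf j)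
      expand : ∀ b → first-row b ≈ₚ whenNonZero (r b) (h 0 b ⊗ mpermRows t (updateAt r b pred) (h ∘ suc))
      expand b with r b in rb
      ... | zero  = ≈-trans (sumL-map-⊗ˡ (h 0 b) rest _)
                      (≈-trans (p⊗-cong ≈-refl (≡⇒≈ₚ (cong (sumL ∘ map rest) no-words))) (zeroʳ _))
        where
        no-words : filter (hasFibres? r ∘ (b ∷_)) (allFuns t (allFin n)) ≡ []
        no-words = Listₚ.filter-none (hasFibres? r ∘ (b ∷_))
                     (All.universal (λ τ hf → proj₁ (Equivalence.to (HasFibres-∷ {r = r}) hf) rb) (allFuns t (allFin n)))
      ... | suc _ = ≈-trans (sumL-map-⊗ˡ (h 0 b) rest _)
                      (p⊗-cong ≈-refl (≡⇒≈ₚ (cong (sumL ∘ map rest) (Listₚ.filter-≐ _ _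
                        ((λ hf → proj₂ (Equivalence.to HasFibres-∷ hf)) ,
                         (λ hf → Equivalence.from HasFibres-∷ (≡suc⇒≢0 rb , hf)))
                        (allFuns t (allFin n))))))

  sgn-*-sgn : ∀ j → sgn j K.* sgn j K.≈ K.1#
  sgn-*-sgn zero    = K.*-identityˡ K.1#
  sgn-*-sgn (suc j) = K.trans (K.sym (-‿distribˡ-* _ _))
                        (K.trans (K.-‿cong (K.sym (-‿distribʳ-* _ _))) (K.trans (-‿involutive _) (sgn-*-sgn j)))
    where open RingProperties (CommutativeRing.ring K.commutativeRing)

  DcAtMost-≈ : ∀ {N} {f g : Poly (Fin N)} {M} → DcAtMost f M → f ≈ₚ g → DcAtMost g M
  DcAtMost-≈ (m , m≤M , A , det≈f) f≈g = m , m≤M , A , ≈-trans det≈f f≈g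

  DcAtMost-≤ : ∀ {N} {f : Poly (Fin N)} {M M′} → DcAtMost f M → M ≤ M′ → DcAtMost f M′
  DcAtMost-≤ (m , m≤M , A , det≈f) M≤M′ = m , ≤-trans m≤M M≤M′ , A , det≈f

  module _ {nv : ℕ} where
    open PolyRing (Fin nv)

    infixl 6 _+ₐ_
    _+ₐ_ : Affine nv → Affine nv → Affine nv
    affine a as +ₐ affine b bs = affine (a K.+ b) (λ v → as v K.+ bs v)

    constₐ : K.Carrier → Affine nv
    constₐ a = affine a (λ _ → K.0#)

    indicator : ∀ {p} {P : Set p} → Dec P → K.Carrier
    indicator (yes _) = K.1#
    indicator (no _)  = K.0#

    varₐ : Fin nv → Affine nv
    varₐ v = affine K.0# (λ u → indicator (u Finₚ.≟ v))

    Σₐ : ∀ n → (Fin n → Affine nv) → Affine nv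
    Σₐ zero    f = constₐ K.0#
    Σₐ (suc n) f = f zero +ₐ Σₐ n (f ∘ suc)

    toPoly-+ₐ : ∀ x y → toPoly (x +ₐ y) ≈ₚ toPoly x ⊕ toPoly y
    toPoly-+ₐ (affine a as) (affine b bs) = begin
      con (a K.+ b) ⊕ Σᶠ nv (λ v → con (as v K.+ bs v) ⊗ var v)
        ≈⟨ p⊕-cong (p-con-+ a b)
                   (Σᶠ-cong nv (λ v → ≈-trans (p⊗-cong (p-con-+ _ _) ≈-refl) (distribʳ (var v) _ _))) ⟩
      (con a ⊕ con b) ⊕ Σᶠ nv (λ v → con (as v) ⊗ var v ⊕ con (bs v) ⊗ var v)
        ≈⟨ p⊕-cong ≈-refl (Σᶠ-distrib-⊕ nv _ _) ⟩
      (con a ⊕ con b) ⊕ (Σᶠ nv (λ v → con (as v) ⊗ var v) ⊕ Σᶠ nv (λ v → con (bs v) ⊗ var v))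
        ≈⟨ interchange _ _ _ _ ⟩
      toPoly (affine a as) ⊕ toPoly (affine b bs) ∎

    toPoly-constₐ : ∀ a → toPoly (constₐ a) ≈ₚ con a
    toPoly-constₐ a = ≈-trans (p⊕-cong ≈-refl (Σᶠ-zero nv (λ v → zeroˡ _))) (+-identityʳ _)

    toPoly-varₐ : ∀ v → toPoly (varₐ v) ≈ₚ var v
    toPoly-varₐ v = ≈-trans (+-identityˡ _) (≈-trans (Σᶠ-single nv _ v off) on)
      where
      off : ∀ u → u ≢ v → con (indicator (u Finₚ.≟ v)) ⊗ var u ≈ₚ con K.0#
      off u u≢v with u Finₚ.≟ v
      ... | yes u≡v = contradiction u≡v u≢v
      ... | no _    = zeroˡ _
      on : con (indicator (v Finₚ.≟ v)) ⊗ var v ≈ₚ var v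
      on with v Finₚ.≟ v
      ... | yes _   = *-identityˡ _
      ... | no v≢v  = contradiction refl v≢v

    toPoly-Σₐ : ∀ n f → toPoly (Σₐ n f) ≈ₚ Σᶠ n (toPoly ∘ f)
    toPoly-Σₐ zero    f = toPoly-constₐ K.0#
    toPoly-Σₐ (suc n) f = ≈-trans (toPoly-+ₐ _ _) (p⊕-cong ≈-refl (toPoly-Σₐ n (f ∘ suc)))

    select : ∀ {p} {A : Set p} → Dec A → Affine nv → Affine nv
    select (yes _) x = x
    select (no _)  x = constₐ K.0#

    toPoly-select-no : ∀ {p} {A : Set p} (d : Dec A) x → ¬ A → toPoly (select d x) ≈ₚ con K.0#
    toPoly-select-no (yes a) x ¬a = contradiction a ¬a
    toPoly-select-no (no _)  x ¬a = toPoly-constₐ K.0#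

    toPoly-select-yes : ∀ {p} {A : Set p} (d : Dec A) x → A → toPoly (select d x) ≈ₚ toPoly x
    toPoly-select-yes (yes _) x a = ≈-refl
    toPoly-select-yes (no ¬a) x a = contradiction a ¬a

    -- Rows are indexed by ℕ so that they can be offset; indices beyond γ are never read.
    atRow : ∀ γ → (Fin γ → Affine nv) → ℕ → Affine nv
    atRow γ F k with k <? γ
    ... | yes k<γ = F (Fin.fromℕ< k<γ)
    ... | no _    = constₐ K.0#

    atRow-toℕ : ∀ {γ} (F : Fin γ → Affine nv) i → atRow γ F (toℕ i) ≡ F i
    atRow-toℕ {γ} F i with toℕ i <? γ
    ... | yes i<γ = cong F (Finₚ.fromℕ<-toℕ i i<γ)
    ... | no i≮γ  = contradiction (Finₚ.toℕ<n i) i≮γ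

    -- Branching programs and Hessenberg determinants

    -- f u is the total weight of the paths from u to the last vertex in the acyclic graph w.
    record PathWeights {P} (w : Fin P → Fin P → Affine nv) (f : Fin P → Poly (Fin nv)) : Set (c ⊔ ℓ) where
      field
        acyclic : ∀ u v → toℕ v ≤ toℕ u → toPoly (w u v) ≈ₚ con K.0#
        at-sink : ∀ u → suc (toℕ u) ≡ P → f u ≈ₚ con K.1#
        step    : ∀ u → suc (toℕ u) < P → f u ≈ₚ Σᶠ P (λ v → toPoly (w u v) ⊗ f v)

    shift : ∀ {P} {A : Set c} → (Fin (suc P) → Fin (suc P) → A) → Fin P → Fin P → A
    shift w u v = w (suc u) (suc v)

    PathWeights-shift : ∀ {P w f} → PathWeights {suc P} w f → PathWeights (shift w) (tail f)
    PathWeights-shift {P} {w} {f} pw = record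
      { acyclic = λ u v v≤u → acyclic (suc u) (suc v) (s≤s v≤u)
      ; at-sink = λ u last → at-sink (suc u) (cong suc last)
      ; step    = λ u u<P → ≈-trans (step (suc u) (s≤s u<P))
                              (≈-trans (p⊕-cong (no-loop u) ≈-refl) (+-identityˡ _))
      }
      where
      open PathWeights pw
      no-loop : ∀ u → toPoly (w (suc u) zero) ⊗ f zero ≈ₚ con K.0#
      no-loop u = ≈-trans (p⊗-cong (acyclic (suc u) zero z≤n) ≈-refl) (zeroˡ _)

    hessenberg : ∀ {N} → (Fin (suc N) → Fin (suc N) → Affine nv) → Fin N → Fin N → Affine nv
    hessenberg w zero          j       = w zero (suc j)
    hessenberg w (suc i)       (suc j) = hessenberg (shift w) i j
    hessenberg w (suc zero)    zero    = constₐ (K.- K.1#)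
    hessenberg w (suc (suc i)) zero    = constₐ K.0#

    det-hessenberg : ∀ N {w : Fin (suc N) → Fin (suc N) → Affine nv} {f} → PathWeights w f →
                     det N (λ i j → toPoly (hessenberg w i j)) ≈ₚ f zero
    -- Deleting the first row and column j leaves a block triangular matrix: j diagonal entries −1,
    -- then the Hessenberg matrix of the vertices from j + 1 on.
    det-hessenberg-minor : ∀ m {w : Fin (suc (suc m)) → Fin (suc (suc m)) → Affine nv} {f} → PathWeights w f →
      ∀ j → det m (λ i l → toPoly (hessenberg w (suc i) (Fin.punchIn j l))) ≈ₚ con (sgn (toℕ j)) ⊗ f (suc j)

    det-hessenberg zero    pw = ≈-sym (PathWeights.at-sink pw zero refl)
    det-hessenberg (suc m) {w} {f} pw = begin
      Σᶠ (suc m) (λ j → con (sgn (toℕ j)) ⊗ toPoly (w zero (suc j))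
                          ⊗ det m (λ i l → toPoly (hessenberg w (suc i) (Fin.punchIn j l))))
        ≈⟨ Σᶠ-cong (suc m) (λ j → ≈-trans (p⊗-cong ≈-refl (det-hessenberg-minor m pw j))
                                          (signs-cancel _ (toPoly (w zero (suc j))) (f (suc j)) (sgn-*-sgn (toℕ j)))) ⟩
      Σᶠ (suc m) (λ j → toPoly (w zero (suc j)) ⊗ f (suc j))
        ≈⟨ ≈-sym (+-identityˡ _) ⟩
      con K.0# ⊕ Σᶠ (suc m) (λ j → toPoly (w zero (suc j)) ⊗ f (suc j))
        ≈⟨ p⊕-cong (≈-sym (≈-trans (p⊗-cong (acyclic zero zero z≤n) ≈-refl) (zeroˡ _))) ≈-refl ⟩
      Σᶠ (suc (suc m)) (λ v → toPoly (w zero v) ⊗ f v)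
        ≈⟨ ≈-sym (step zero (s≤s (s≤s z≤n))) ⟩
      f zero ∎
      where
      open PathWeights pw
      signs-cancel : ∀ s a p → s K.* s K.≈ K.1# → con s ⊗ a ⊗ (con s ⊗ p) ≈ₚ a ⊗ p
      signs-cancel s a p s²≈1 = begin
        con s ⊗ a ⊗ (con s ⊗ p)   ≈⟨ p⊗-cong (*-comm _ _) ≈-refl ⟩
        a ⊗ con s ⊗ (con s ⊗ p)   ≈⟨ *-assoc _ _ _ ⟩
        a ⊗ (con s ⊗ (con s ⊗ p)) ≈⟨ p⊗-cong ≈-refl (≈-sym (*-assoc _ _ _)) ⟩
        a ⊗ (con s ⊗ con s ⊗ p)   ≈⟨ p⊗-cong ≈-refl (p⊗-cong (≈-trans (≈-sym (p-con-* s s)) (p-con-cong s²≈1))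
                                                     ≈-refl) ⟩
        a ⊗ (con K.1# ⊗ p)        ≈⟨ p⊗-cong ≈-refl (*-identityˡ p) ⟩
        a ⊗ p                     ∎

    det-hessenberg-minor m       pw zero    = ≈-trans (det-hessenberg m (PathWeights-shift pw)) (≈-sym (*-identityˡ _))
    det-hessenberg-minor (suc m) {w} {f} pw (suc j) = begin
      det (suc m) M
        ≈⟨ det-column₀ m M (λ i → toPoly-constₐ K.0#) ⟩
      M zero zero ⊗ det m (λ i l → M (suc i) (suc l))
        ≈⟨ p⊗-cong (toPoly-constₐ (K.- K.1#)) (det-hessenberg-minor m (PathWeights-shift pw) j) ⟩
      con (K.- K.1#) ⊗ (con (sgn (toℕ j)) ⊗ f (suc (suc j)))
        ≈⟨ ≈-sym (*-assoc _ _ _) ⟩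
      con (K.- K.1#) ⊗ con (sgn (toℕ j)) ⊗ f (suc (suc j))
        ≈⟨ p⊗-cong (≈-trans (≈-sym (p-con-* _ _)) (p-con-cong (-1*x≈-x _))) ≈-refl ⟩
      con (sgn (toℕ (suc j))) ⊗ f (suc (suc j)) ∎
      where
      open RingProperties (CommutativeRing.ring K.commutativeRing) using (-1*x≈-x)
      M : Fin (suc m) → Fin (suc m) → Poly (Fin nv)
      M i l = toPoly (hessenberg w (suc i) (Fin.punchIn (suc j) l))

    -- The source is any s with toℕ s ≡ 0, so that P need not be a successor syntactically.
    dc-pathWeight : ∀ {P w f} → PathWeights {P} w f → (s : Fin P) → toℕ s ≡ 0 → DcAtMost (f s) (P ∸ 1)
    dc-pathWeight {suc N} {w} pw zero refl = N , ≤-refl , hessenberg w , det-hessenberg N pw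

    -- Vertex u stands for r = decode m u; a path from r to 0 reads the rows γ − |r|, …, γ − 1
    -- and lowers each coordinate b exactly r b times.
    module MpermProgram {n} (m : Fin n → ℕ) (Y : ℕ → Fin n → Affine nv) where
      γ : ℕ
      γ = sumℕ n m

      h : ℕ → Fin n → Poly (Fin nv)
      h k j = toPoly (Y k j)

      P : ℕ
      P = boxSize n m

      row : Fin P → ℕ
      row u = γ ∸ sumℕ n (decode m u)

      f : Fin P → Poly (Fin nv)
      f u = mpermRows (sumℕ n (decode m u)) (decode m u) (λ k → h (k + row u))

      target : Fin P → Fin n → Fin P
      target u b = encode m (updateAt (decode m u) b pred)

      Edge : Fin P → Fin P → Fin n → Set
      Edge u v b = decode m u b ≢ 0 × v ≡ target u b

      edge? : ∀ u v b → Dec (Edge u v b)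
      edge? u v b = ¬? (decode m u b ℕ.≟ 0) ×-dec (v Finₚ.≟ target u b)

      w : Fin P → Fin P → Affine nv
      w u v = Σₐ n (λ b → select (edge? u v b) (Y (row u) b))

      <-target : ∀ u b → decode m u b ≢ 0 → toℕ u < toℕ (target u b)
      <-target u b rb≢0 =
        ≡.subst (λ x → toℕ x < toℕ (target u b)) (encode-decode m u)
          (encode-updateAt-pred m (decode m u) (decode-≤ m u) b
            (≡.sym (suc-pred (decode m u b) {{ℕ.≢-nonZero rb≢0}})))

      at-bottom : ∀ u → sumℕ n (decode m u) ≡ 0 → u ≡ encode m (λ _ → 0)
      at-bottom u sum≡0 = ≡.trans (≡.sym (encode-decode m u)) (encode-cong m (sumℕ≡0⇒≡0 n _ sum≡0))

      acyclic : ∀ u v → toℕ v ≤ toℕ u → toPoly (w u v) ≈ₚ con K.0#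
      acyclic u v v≤u = ≈-trans (toPoly-Σₐ n _) (Σᶠ-zero n (λ b → toPoly-select-no (edge? u v b) _ (no-edge b)))
        where
        no-edge : ∀ b → ¬ Edge u v b
        no-edge b (rb≢0 , refl) = <⇒≱ (<-target u b rb≢0) v≤u

      at-sink : ∀ u → suc (toℕ u) ≡ P → f u ≈ₚ con K.1#
      at-sink u last = ≈-trans (≡⇒≈ₚ (cong (λ s → mpermRows s (decode m u) (λ k → h (k + row u))) sum≡0))
                               (mpermRows-zero (λ k → h (k + row u)) r≗0)
        where
        u≡bottom : u ≡ encode m (λ _ → 0)
        u≡bottom = Finₚ.toℕ-injective (suc-injective (≡.trans last (≡.sym (suc-toℕ-encode-bottom m))))
        r≗0 : decode m u ≗ (λ _ → 0)
        r≗0 j = ≡.trans (cong (λ x → decode m x j) u≡bottom) (decode-encode m _ (λ _ → z≤n) j)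
        sum≡0 : sumℕ n (decode m u) ≡ 0
        sum≡0 = ≡.trans (sumℕ-cong n r≗0) (≡.trans (sumℕ-const n 0) (ℕₚ.*-zeroʳ n))

      f-target : ∀ u b {k t} → decode m u b ≡ suc k → sumℕ n (decode m u) ≡ suc t →
                 f (target u b) ≈ₚ mpermRows t (updateAt (decode m u) b pred) (λ x → h (suc x + row u))
      f-target u b {t = t} rb sum≡ = ≈-trans (≡⇒≈ₚ (cong (λ s → mpermRows s (decode m T) (λ x → h (x + row T))) sumT))
                                     (mpermRows-cong _ rT (λ x j → ≡⇒≈ₚ (cong (λ y → h y j) (shifted x))))
        where
        T : Fin P
        T = target u b
        rT : decode m T ≗ updateAt (decode m u) b pred
        rT = decode-encode m _ (updateAt-pred-≤ (decode-≤ m u) b)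
        sumT : sumℕ n (decode m T) ≡ t
        sumT = suc-injective (≡.trans (cong suc (sumℕ-cong n rT)) (≡.trans (sumℕ-updateAt-pred n _ b rb) sum≡))
        row-T : row T ≡ suc (row u)
        row-T = ≡.trans (cong (γ ∸_) sumT)
                  (≡.trans (+-∸-assoc 1 (≤-trans (≤-reflexive (≡.sym sum≡)) (sumℕ-mono n (decode-≤ m u))))
                           (cong (λ s → suc (γ ∸ s)) (≡.sym sum≡)))
        shifted : ∀ x → x + row T ≡ suc x + row u
        shifted x = ≡.trans (cong (x +_) row-T) (+-suc x (row u))

      out-edges : ∀ u {t} → sumℕ n (decode m u) ≡ suc t → ∀ b →
        whenNonZero (decode m u b) (h (row u) b ⊗ mpermRows t (updateAt (decode m u) b pred) (λ x → h (suc x + row u)))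
          ≈ₚ Σᶠ P (λ v → toPoly (select (edge? u v b) (Y (row u) b)) ⊗ f v)
      out-edges u {t} sum≡ b = by-cases (decode m u b) refl
        where
        by-cases : ∀ a → decode m u b ≡ a →
          whenNonZero a (h (row u) b ⊗ mpermRows t (updateAt (decode m u) b pred) (λ x → h (suc x + row u)))
            ≈ₚ Σᶠ P (λ v → toPoly (select (edge? u v b) (Y (row u) b)) ⊗ f v)
        by-cases zero    rb = ≈-sym (Σᶠ-zero P (λ v →
          ≈-trans (p⊗-cong (toPoly-select-no (edge? u v b) _ (λ e → proj₁ e rb)) ≈-refl) (zeroˡ _)))
        by-cases (suc _) rb = begin
          h (row u) b ⊗ mpermRows t (updateAt (decode m u) b pred) (λ x → h (suc x + row u))
            ≈⟨ p⊗-cong ≈-refl (≈-sym (f-target u b rb sum≡)) ⟩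
          h (row u) b ⊗ f T
            ≈⟨ p⊗-cong (≈-sym (toPoly-select-yes (edge? u T b) _ (≡suc⇒≢0 rb , refl))) ≈-refl ⟩
          toPoly (select (edge? u T b) (Y (row u) b)) ⊗ f T
            ≈⟨ Σᶠ-single P _ T (λ v v≢T →
                 ≈-trans (p⊗-cong (toPoly-select-no (edge? u v b) _ (v≢T ∘ proj₂)) ≈-refl) (zeroˡ _)) ⟨
          Σᶠ P (λ v → toPoly (select (edge? u v b) (Y (row u) b)) ⊗ f v) ∎
          where
          T : Fin P
          T = target u b

      step : ∀ u → suc (toℕ u) < P → f u ≈ₚ Σᶠ P (λ v → toPoly (w u v) ⊗ f v)
      step u u<P = by-size (sumℕ n (decode m u)) refl
        where
        by-size : ∀ s → sumℕ n (decode m u) ≡ s → f u ≈ₚ Σᶠ P (λ v → toPoly (w u v) ⊗ f v)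
        by-size zero sum≡0 = contradiction
          (≡.trans (cong (suc ∘ toℕ) (at-bottom u sum≡0)) (suc-toℕ-encode-bottom m)) (<⇒≢ u<P)
        by-size (suc t) sum≡ = begin
          f u
            ≈⟨ ≡⇒≈ₚ (cong (λ s → mpermRows s (decode m u) (λ k → h (k + row u))) sum≡) ⟩
          mpermRows (suc t) (decode m u) (λ k → h (k + row u))
            ≈⟨ mpermRows-suc t (decode m u) (λ k → h (k + row u)) ⟩
          Σᶠ n (λ b → whenNonZero (decode m u b)
                        (h (row u) b ⊗ mpermRows t (updateAt (decode m u) b pred) (λ x → h (suc x + row u))))
            ≈⟨ Σᶠ-cong n (out-edges u sum≡) ⟩
          Σᶠ n (λ b → Σᶠ P (λ v → toPoly (select (edge? u v b) (Y (row u) b)) ⊗ f v))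
            ≈⟨ Σᶠ-comm n P _ ⟩
          Σᶠ P (λ v → Σᶠ n (λ b → toPoly (select (edge? u v b) (Y (row u) b)) ⊗ f v))
            ≈⟨ Σᶠ-cong P (λ v → ≈-trans (p⊗-cong (toPoly-Σₐ n _) ≈-refl) (Σᶠ-distribʳ-⊗ n _ (f v))) ⟨
          Σᶠ P (λ v → toPoly (w u v) ⊗ f v) ∎

      pathWeights : PathWeights w f
      pathWeights = record { acyclic = acyclic ; at-sink = at-sink ; step = step }

      at-source : f (encode m m) ≈ₚ mpermRows γ m h
      at-source = ≈-trans (≡⇒≈ₚ (cong (λ s → mpermRows s (decode m s₀) (λ k → h (k + row s₀))) sum≡γ))
                          (mpermRows-cong γ {h = λ k → h (k + row s₀)} r≗m
                                          (λ k j → ≡⇒≈ₚ (cong (λ x → h x j) k+row≡k)))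
        where
        s₀ : Fin P
        s₀ = encode m m
        r≗m : decode m s₀ ≗ m
        r≗m = decode-encode m m (λ _ → ≤-refl)
        sum≡γ : sumℕ n (decode m s₀) ≡ γ
        sum≡γ = sumℕ-cong n r≗m
        k+row≡k : ∀ {k} → k + row s₀ ≡ k
        k+row≡k {k} = ≡.trans (cong (λ s → k + (γ ∸ s)) sum≡γ)
                              (≡.trans (cong (k +_) (n∸n≡0 γ)) (ℕₚ.+-identityʳ k))

    dc-mpermRows : ∀ {n} (m : Fin n → ℕ) (Y : ℕ → Fin n → Affine nv) →
                   DcAtMost (mpermRows (sumℕ n m) m (λ k j → toPoly (Y k j))) (boxSize n m ∸ 1)
    dc-mpermRows m Y = DcAtMost-≈ (dc-pathWeight pathWeights (encode m m) (toℕ-encode-top m)) at-source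
      where open MpermProgram m Y

  dc-mperm : ∀ γ n (m : Fin n → ℕ) → sumℕ n m ≡ γ → DcAtMost (mperm γ m) (boxSize n m ∸ 1)
  dc-mperm .(sumℕ n m) n m refl = DcAtMost-≈ (dc-mpermRows m Y) (≈-sym mperm≈mpermRows)
    where
    γ : ℕ
    γ = sumℕ n m
    Y : ℕ → Fin n → Affine (γ * n)
    Y k j = atRow γ (λ i → varₐ (mvar i j)) k
    mperm≈mpermRows : mperm γ m ≈ₚ mpermRows γ m (λ k j → toPoly (Y k j))
    mperm≈mpermRows = sumL-map-cong (λ σ → Πᶠ-cong γ (λ i →
      ≈-sym (≈-trans (≡⇒≈ₚ (cong toPoly (atRow-toℕ (λ i′ → varₐ (mvar i′ (σ i))) i))) (toPoly-varₐ _))))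
      (Σₘ γ m)

  dc-hoperm : ∀ n → DcAtMost (hoperm n) (3 ^ n)
  dc-hoperm n = DcAtMost-≤ (DcAtMost-≈ (dc-mpermRows ones Y) (≈-sym hoperm≈mpermRows))
                           (≤-trans (m∸n≤m _ 1) (boxSize-ones n))
    where
    open PolyRing (Fin (n * (2 * n)))
    ones : Fin n → ℕ
    ones _ = 1
    signs : List Bool
    signs = true List.∷ false List.∷ []
    signed : (Fin n → Fin n) → Fin n → Bool → Poly (Fin (n * (2 * n)))
    signed σ i s = var (hvar i s (σ i))
    Y : ℕ → Fin n → Affine (n * (2 * n))
    Y k j = atRow n (λ i → varₐ (hvar i true j) +ₐ varₐ (hvar i false j)) k
    Y-signs : ∀ σ i → toPoly (Y (toℕ i) (σ i)) ≈ₚ sumL (map (signed σ i) signs)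
    Y-signs σ i = begin
      toPoly (Y (toℕ i) (σ i))
        ≡⟨ cong toPoly (atRow-toℕ (λ i′ → varₐ (hvar i′ true (σ i)) +ₐ varₐ (hvar i′ false (σ i))) i) ⟩
      toPoly (varₐ (hvar i true (σ i)) +ₐ varₐ (hvar i false (σ i)))
        ≈⟨ ≈-trans (toPoly-+ₐ _ _) (p⊕-cong (toPoly-varₐ _) (≈-trans (toPoly-varₐ _) (≈-sym (+-identityʳ _)))) ⟩
      sumL (map (signed σ i) signs) ∎
    Sₙ≡Σₘ : Sₙ n ≡ Σₘ n ones
    Sₙ≡Σₘ = Listₚ.filter-≐ isPerm? (hasFibres? ones)
              ((λ {σ} → IsPerm⇒HasFibres-ones σ) , (λ {σ} → HasFibres-ones⇒IsPerm σ)) (allFuns n (allFin n))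
    hoperm≈mpermRows : hoperm n ≈ₚ mpermRows (sumℕ n ones) ones (λ k j → toPoly (Y k j))
    hoperm≈mpermRows = begin
      hoperm n
        ≈⟨ sumL-concatMap _ (Sₙ n) ⟩
      sumL (map (λ σ → sumL (map (λ ε → Πᶠ n (λ i → signed σ i (ε i))) (allFuns n signs))) (Sₙ n))
        ≈⟨ sumL-map-cong (λ σ → sumL-allFuns-Πᶠ n signs (signed σ)) (Sₙ n) ⟩
      sumL (map (λ σ → Πᶠ n (λ i → sumL (map (signed σ i) signs))) (Sₙ n))
        ≡⟨ cong (λ σs → sumL (map (λ σ → Πᶠ n (λ i → sumL (map (signed σ i) signs))) σs)) Sₙ≡Σₘ ⟩
      sumL (map (λ σ → Πᶠ n (λ i → sumL (map (signed σ i) signs))) (Σₘ n ones))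
        ≈⟨ sumL-map-cong (λ σ → Πᶠ-cong n (λ i → ≈-sym (Y-signs σ i))) (Σₘ n ones) ⟩
      mpermRows n ones (λ k j → toPoly (Y k j))
        ≡⟨ cong (λ t → mpermRows t ones (λ k j → toPoly (Y k j))) (≡.trans (sumℕ-const n 1) (ℕₚ.*-identityʳ n)) ⟨
      mpermRows (sumℕ n ones) ones (λ k j → toPoly (Y k j)) ∎

theorem1p3 : ∀ {c ℓ : Level} (k : Field c ℓ) →
    let open Polys k in
    (∀ (n : ℕ) → 1 ≤ n → DcAtMost (hoperm n) (3 ^ n))
    × (∀ (γ : ℕ) → 1 ≤ γ → ∀ (n : ℕ) (m : Fin n → ℕ) → (∀ i → 1 ≤ m i) →
    sumℕ n m ≡ γ →
    DcAtMost (mperm γ m) (prodℕ n (λ i → m i + 1) ∸ 1))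
theorem1p3 k = (λ n _ → dc-hoperm k n) , (λ γ _ n m _ → dc-mperm k γ n m)
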